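{- For all even $n\in\mathbb{N}$, $Z_{DP}(n) \ge n^2/4 - n$.
   Context: All graphs are finite, undirected and simple; $\chi(G)$ is the chromatic number. For a graph $G$ and $s \in \mathbb{N}$, $\mathcal{J}(G,s)$ denotes the join of $G$ with a copy of $K_s$: the graph obtained from $G$ by adding $s$ new vertices adjacent to every vertex of $G$ and to each other. A cover of a graph $G$ is a pair $(L,H)$, where $H$ is a graph and $L\colon V(G)\to 2^{V(H)}$, such that: the sets $L(u)$, $u\in V(G)$, partition $V(H)$; if $u,v\in V(G)$ and some vertex of $L(v)$ is adjacent in $H$ to some vertex of $L(u)$, then $v=u$ or $uv\in E(G)$; each $H[L(u)]$ is a complete graph; and if $uv\in E(G)$, then the set of edges of $H$ between $L(u)$ and $L(v)$ is a matching (possibly empty). An $(L,H)$-coloring of $G$ is an independent set $I$ of $H$ with $|I\cap L(u)|=1$ for all $u\in V(G)$. The DP-chromatic number $\chi_{DP}(G)$ is the smallest $k$ such that $G$ is $(L,H)$-colorable for every cover $(L,H)$ with $|L(u)|\ge k$ for all $u$. $Z_{DP}(G) := \min\{ s\in \mathbb{N} : \chi_{DP}(\mathcal{J}(G,s)) = \chi(\mathcal{J}(G,s))\}$, and $Z_{DP}(n) := \max\{Z_{DP}(G) : G \text{ a graph with } |V(G)|=n\}$. -}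

module Defs where

open import Data.Nat using (ℕ; _≤_; _<_)
open import Data.Fin using (Fin)
open import Data.Sum using (_⊎_; inj₁; inj₂)
open import Data.Product using (Σ; _×_; _,_; ∃)
open import Data.Unit using (⊤; tt)
open import Data.Empty using (⊥)
open import Relation.Nullary using (¬_)
open import Relation.Binary.PropositionalEquality using (_≡_; _≢_; refl; sym)

record Graph (V : Set) : Set₁ where
  field
    E      : V → V → Set
    symE   : ∀ {x y} → E x y → E y x
    irrefl : ∀ {x} → ¬ E x x
open Graph public

Colorable : {V : Set} → Graph V → ℕ → Set
Colorable {V} G k = Σ (V → Fin k) λ c → ∀ x y → E G x y → c x ≢ c y

IsChromaticNumber : {V : Set} → Graph V → ℕ → Set
IsChromaticNumber G k = Colorable G k × (∀ j → j < k → ¬ Colorable G j)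

-- A cover (L,H) of G.  The vertex set of H is  Σ u, Fin (size u),
-- and L(u) = { (u , i) | i : Fin (size u) }; so the L(u) partition V(H).
record Cover {V : Set} (G : Graph V) : Set₁ where
  field
    size : V → ℕ
    H    : Graph (Σ V (λ u → Fin (size u)))
    edgesOK  : ∀ u v (i : Fin (size u)) (j : Fin (size v)) →
               E H (u , i) (v , j) → u ≢ v → E G u v
    clique   : ∀ u (i j : Fin (size u)) → i ≢ j → E H (u , i) (u , j)
    matching : ∀ u v → E G u v → (i : Fin (size u)) (j j' : Fin (size v)) →
               E H (u , i) (v , j) → E H (u , i) (v , j') → j ≡ j'
open Cover public

-- An (L,H)-colouring: an independent set of H meeting each L(u) in exactly
-- one vertex, represented by the function u ↦ the unique chosen vertex of L(u).
CoverColorable : {V : Set} {G : Graph V} → Cover G → Set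
CoverColorable {V} C =
  Σ ((u : V) → Fin (size C u)) λ pick →
    ∀ u v → ¬ E (H C) (u , pick u) (v , pick v)

DPColorable : {V : Set} → Graph V → ℕ → Set₁
DPColorable G k = (C : Cover G) → (∀ u → k ≤ size C u) → CoverColorable C

IsDPChromaticNumber : {V : Set} → Graph V → ℕ → Set₁
IsDPChromaticNumber G k = DPColorable G k × (∀ j → j < k → ¬ DPColorable G j)

DPEqualsChromatic : {V : Set} → Graph V → Set₁
DPEqualsChromatic G = ∃ λ k → IsDPChromaticNumber G k × IsChromaticNumber G k

joinE : ∀ {n} → Graph (Fin n) → (s : ℕ) → Fin n ⊎ Fin s → Fin n ⊎ Fin s → Set
joinE G s (inj₁ a) (inj₁ b) = E G a b
joinE G s (inj₁ a) (inj₂ b) = ⊤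
joinE G s (inj₂ a) (inj₁ b) = ⊤
joinE G s (inj₂ a) (inj₂ b) = a ≢ b

joinSym : ∀ {n} (G : Graph (Fin n)) s {x y} → joinE G s x y → joinE G s y x
joinSym G s {inj₁ a} {inj₁ b} e = symE G e
joinSym G s {inj₁ a} {inj₂ b} e = tt
joinSym G s {inj₂ a} {inj₁ b} e = tt
joinSym G s {inj₂ a} {inj₂ b} e = λ p → e (sym p)

joinIrr : ∀ {n} (G : Graph (Fin n)) s {x} → ¬ joinE G s x x
joinIrr G s {inj₁ a} e = irrefl G e
joinIrr G s {inj₂ a} e = e refl

Join : ∀ {n} → Graph (Fin n) → (s : ℕ) → Graph (Fin n ⊎ Fin s)
Join G s = record { E = joinE G s ; symE = λ {x} {y} → joinSym G s {x} {y} ; irrefl = λ {x} → joinIrr G s {x} }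

-- Z_DP(G) ≥ t  :⟺  no s < t has χ_DP(J(G,s)) = χ(J(G,s)).
ZDPAtLeast : ∀ {n} → Graph (Fin n) → ℕ → Set₁
ZDPAtLeast G t = ∀ s → s < t → ¬ DPEqualsChromatic (Join G s)

-- Z_DP(n) ≥ t  :⟺  some n-vertex graph G has Z_DP(G) ≥ t.
ZDPnAtLeast : ℕ → ℕ → Set₁
ZDPnAtLeast n t = Σ (Graph (Fin n)) λ G → ZDPAtLeast G t

-- Take G = K_{q,q} with q = p + 1, so that n²/4 − n = p² − 1. Give every vertex of J(G,s) the
-- colours 0, …, s+1 and match K_s to everything by the identity; then a colouring uses only two
-- colours on G. Fix vertices a₀, b₀ on the two sides and put the identity matching on all edges at
-- them: this forces one colour α on the whole a-side and another colour β on the b-side. The other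
-- p² edges carry the matchings c + d ≡ K (mod s+2), and once s + 2 ≤ p² every residue K occurs, so
-- the edge with K ≡ α + β is violated. Hence χ_DP(J(G,s)) > s + 2 ≥ χ(J(G,s)) for all s < p² − 1.
module Submission where

open import Defs
open import Data.Nat using (ℕ; _*_; _∸_; _/_)
open import Data.Nat.Divisibility using (_∣_)
open import Data.Nat using (suc; _+_; _≤_; _<_; _<?_; s≤s⁻¹)
open import Data.Nat.Properties
open import Data.Nat.DivMod using (m*n/n≡m)
open import Data.Nat.Divisibility using (divides)
open import Data.Nat.Tactic.RingSolver using (solve-∀)
open import Data.Fin using (Fin; toℕ; fromℕ<; join; splitAt; combine) renaming (suc to fsuc)
open import Data.Fin.Patterns using (0F; 1F; 2F)
open import Data.Fin.Properties
  using (toℕ<n; toℕ-injective; toℕ-fromℕ<; join-splitAt; splitAt-join; injective⇒≤; combine-surjective)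
  renaming (_≟_ to _≟ᶠ_)
open import Data.Sum using (_⊎_; inj₁; inj₂; [_,_]′; map₁)
open import Data.Sum.Properties using (inj₁-injective; inj₂-injective)
open import Data.Product using (Σ; ∃; ∃₂; _×_; _,_)
open import Data.Unit using (tt)
open import Data.Empty using (⊥; ⊥-elim)
open import Function using (_∘_; const)
open import Function.Definitions using (Injective)
open import Relation.Nullary using (¬_; yes; no)
open import Relation.Binary.PropositionalEquality
  using (_≡_; _≢_; refl; sym; trans; cong; cong₂; subst; subst₂; ≢-sym; module ≡-Reasoning)

DPColorable-mono : ∀ {V} {G : Graph V} {k m} → k ≤ m → DPColorable G k → DPColorable G m
DPColorable-mono k≤m colorable C large = colorable C (λ u → ≤-trans k≤m (large u))

colorable∧¬DPColorable⇒¬DPEqualsChromatic : ∀ {V} {G : Graph V} {m} →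
  Colorable G m → ¬ DPColorable G m → ¬ DPEqualsChromatic G
colorable∧¬DPColorable⇒¬DPEqualsChromatic colorable ¬dp (k , (dpk , _) , (_ , minimal)) =
  ¬dp (DPColorable-mono (≮⇒≥ (λ m<k → minimal _ m<k colorable)) dpk)

join-injective : ∀ m n → Injective _≡_ _≡_ (join m n)
join-injective m n {x} {y} eq =
  trans (sym (splitAt-join m n x)) (trans (cong (splitAt m) eq) (splitAt-join m n y))

splitAt-injective : ∀ m n → Injective _≡_ _≡_ (splitAt m {n})
splitAt-injective m n {i} {j} eq =
  trans (sym (join-splitAt m n i)) (trans (cong (join m n) eq) (join-splitAt m n j))

Join-colorable : ∀ {n k} {G : Graph (Fin n)} s → Colorable G k → Colorable (Join G s) (k + s)
Join-colorable {k = k} {G} s (c , proper) =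
  join k s ∘ map₁ c , λ x y e → separated x y e ∘ join-injective k s
  where
  separated : ∀ x y → joinE G s x y → map₁ c x ≢ map₁ c y
  separated (inj₁ a) (inj₁ b) e = proper a b e ∘ inj₁-injective
  separated (inj₂ a) (inj₂ b) e = e ∘ inj₂-injective
  separated (inj₁ a) (inj₂ b) e ()
  separated (inj₂ a) (inj₁ b) e ()

data Opposite {A B : Set} : A ⊎ B → A ⊎ B → Set where
  left-right : ∀ {a b} → Opposite (inj₁ a) (inj₂ b)
  right-left : ∀ {a b} → Opposite (inj₂ b) (inj₁ a)

Bipartite : {V A B : Set} → (V → A ⊎ B) → Graph V
Bipartite view = record
  { E      = λ x y → Opposite (view x) (view y)
  ; symE   = λ {x} {y} → symmetric (view x) (view y)
  ; irrefl = λ {x} → irreflexive (view x)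
  }
  where
  symmetric : ∀ v w → Opposite v w → Opposite w v
  symmetric _ _ left-right = right-left
  symmetric _ _ right-left = left-right
  irreflexive : ∀ w → ¬ Opposite w w
  irreflexive (inj₁ _) ()
  irreflexive (inj₂ _) ()

Bipartite-colorable : {V A B : Set} (view : V → A ⊎ B) → Colorable (Bipartite view) 2
Bipartite-colorable view = side ∘ view , λ x y → separated
  where
  side : _ ⊎ _ → Fin 2
  side = [ const 0F , const 1F ]′
  separated : ∀ {v w} → Opposite v w → side v ≢ side w
  separated left-right ()
  separated right-left ()

-- Data of a cover with N colours at every vertex: the H-edges between L(u) and L(v) are Match u v.
record Matching {V : Set} (G : Graph V) (N : ℕ) : Set₁ where
  field
    Match      : V → V → Fin N → Fin N → Set
    Match-sym  : ∀ {u v c d} → Match u v c d → Match v u d c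
    functional : ∀ {u v c d d′} → Match u v c d → Match u v c d′ → d ≡ d′
    onEdges    : ∀ {u v c d} → Match u v c d → u ≢ v → E G u v
open Matching

coverOf : ∀ {V} {G : Graph V} {N} → Matching G N → Cover G
coverOf {V} {G} {N} 𝓜 = record
  { size     = const N
  ; H        = record { E = HE ; symE = HE-sym ; irrefl = HE-irrefl }
  ; edgesOK  = λ { u v i j (inj₁ (u≡v , _)) u≢v → ⊥-elim (u≢v u≡v)
                 ; u v i j (inj₂ (_ , m)) u≢v → onEdges 𝓜 m u≢v }
  ; clique   = λ u i j i≢j → inj₁ (refl , i≢j)
  ; matching = matching-functional
  }
  where
  HE : Σ V (const (Fin N)) → Σ V (const (Fin N)) → Set
  HE (u , c) (v , d) = (u ≡ v × c ≢ d) ⊎ (u ≢ v × Match 𝓜 u v c d)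

  HE-sym : ∀ {x y} → HE x y → HE y x
  HE-sym (inj₁ (u≡v , c≢d)) = inj₁ (sym u≡v , ≢-sym c≢d)
  HE-sym (inj₂ (u≢v , m))   = inj₂ (≢-sym u≢v , Match-sym 𝓜 m)

  HE-irrefl : ∀ {x} → ¬ HE x x
  HE-irrefl (inj₁ (_ , c≢c)) = c≢c refl
  HE-irrefl (inj₂ (u≢u , _)) = u≢u refl

  matching-functional : ∀ u v → E G u v → (i j j′ : Fin N) →
                        HE (u , i) (v , j) → HE (u , i) (v , j′) → j ≡ j′
  matching-functional u v e i j j′ (inj₁ (refl , _)) _ = ⊥-elim (irrefl G e)
  matching-functional u v e i j j′ _ (inj₁ (refl , _)) = ⊥-elim (irrefl G e)
  matching-functional u v e i j j′ (inj₂ (_ , m)) (inj₂ (_ , m′)) = functional 𝓜 m m′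

Avoids : ∀ {V} {G : Graph V} {N} → Matching G N → (V → Fin N) → Set
Avoids 𝓜 pick = ∀ u v → u ≢ v → ¬ Match 𝓜 u v (pick u) (pick v)

coverOf-colouring : ∀ {V} {G : Graph V} {N} (𝓜 : Matching G N) →
  CoverColorable (coverOf 𝓜) → Σ (V → Fin N) (Avoids 𝓜)
coverOf-colouring 𝓜 (pick , independent) = pick , λ u v u≢v m → independent u v (inj₂ (u≢v , m))

AtMostTwoColours : ∀ {V N} → (V → Fin N) → Set
AtMostTwoColours col = ∀ x y z → col x ≢ col y → col y ≢ col z → col x ≡ col z

joinMatching : ∀ {n N} {G : Graph (Fin n)} s → Matching G N → Matching (Join G s) N
joinMatching {G = G} s 𝓜 = record
  { Match      = M
  ; Match-sym  = λ {u} {v} → M-sym u v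
  ; functional = λ {u} {v} → M-functional u v
  ; onEdges    = λ {u} {v} → M-onEdges u v
  }
  where
  M : _ → _ → _ → _ → Set
  M (inj₁ x) (inj₁ y) c d = Match 𝓜 x y c d
  M _        _        c d = c ≡ d

  M-sym : ∀ u v {c d} → M u v c d → M v u d c
  M-sym (inj₁ x) (inj₁ y) m = Match-sym 𝓜 m
  M-sym (inj₁ x) (inj₂ y) m = sym m
  M-sym (inj₂ x) (inj₁ y) m = sym m
  M-sym (inj₂ x) (inj₂ y) m = sym m

  M-functional : ∀ u v {c d d′} → M u v c d → M u v c d′ → d ≡ d′
  M-functional (inj₁ x) (inj₁ y) m m′ = functional 𝓜 m m′
  M-functional (inj₁ x) (inj₂ y) m m′ = trans (sym m) m′
  M-functional (inj₂ x) (inj₁ y) m m′ = trans (sym m) m′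
  M-functional (inj₂ x) (inj₂ y) m m′ = trans (sym m) m′

  M-onEdges : ∀ u v {c d} → M u v c d → u ≢ v → joinE G s u v
  M-onEdges (inj₁ x) (inj₁ y) m u≢v = onEdges 𝓜 m (u≢v ∘ cong inj₁)
  M-onEdges (inj₁ x) (inj₂ y) m u≢v = tt
  M-onEdges (inj₂ x) (inj₁ y) m u≢v = tt
  M-onEdges (inj₂ x) (inj₂ y) m u≢v = u≢v ∘ cong inj₂

Avoids-restrict : ∀ {n N s} {G : Graph (Fin n)} {𝓜 : Matching G N} {pick} →
  Avoids (joinMatching s 𝓜) pick → Avoids 𝓜 (pick ∘ inj₁)
Avoids-restrict avoids x y x≢y = avoids (inj₁ x) (inj₁ y) (x≢y ∘ inj₁-injective)

disjoint-injections⇒≤ : ∀ {k s m} {f : Fin k → Fin m} {g : Fin s → Fin m} →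
  Injective _≡_ _≡_ f → Injective _≡_ _≡_ g → (∀ i j → f i ≢ g j) → k + s ≤ m
disjoint-injections⇒≤ {k} {s} {f = f} {g} f-inj g-inj disjoint =
  injective⇒≤ {f = [ f , g ]′ ∘ splitAt k} (splitAt-injective k s ∘ copairing-injective _ _)
  where
  copairing-injective : ∀ x y → [ f , g ]′ x ≡ [ f , g ]′ y → x ≡ y
  copairing-injective (inj₁ i) (inj₁ j) eq = cong inj₁ (f-inj eq)
  copairing-injective (inj₂ i) (inj₂ j) eq = cong inj₂ (g-inj eq)
  copairing-injective (inj₁ i) (inj₂ j) eq = ⊥-elim (disjoint i j eq)
  copairing-injective (inj₂ i) (inj₁ j) eq = ⊥-elim (disjoint j i (sym eq))

outsideInjection-twoValues : ∀ {s} {g : Fin s → Fin (2 + s)} → Injective _≡_ _≡_ g →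
  ∀ x y z → (∀ w → x ≢ g w) → (∀ w → y ≢ g w) → (∀ w → z ≢ g w) → x ≢ y → y ≢ z → x ≡ z
outsideInjection-twoValues {s} {g} g-inj x y z x∉ y∉ z∉ x≢y y≢z with x ≟ᶠ z
... | yes x≡z = x≡z
... | no x≢z  = ⊥-elim (1+n≰n (disjoint-injections⇒≤ {k = 3} triple-injective g-inj triple∉))
  where
  triple : Fin 3 → Fin (2 + s)
  triple 0F = x
  triple 1F = y
  triple 2F = z

  triple∉ : ∀ i w → triple i ≢ g w
  triple∉ 0F = x∉
  triple∉ 1F = y∉
  triple∉ 2F = z∉

  triple-injective : Injective _≡_ _≡_ triple
  triple-injective {0F} {0F} _ = refl
  triple-injective {1F} {1F} _ = refl
  triple-injective {2F} {2F} _ = refl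
  triple-injective {0F} {1F} eq = ⊥-elim (x≢y eq)
  triple-injective {0F} {2F} eq = ⊥-elim (x≢z eq)
  triple-injective {1F} {0F} eq = ⊥-elim (x≢y (sym eq))
  triple-injective {1F} {2F} eq = ⊥-elim (y≢z eq)
  triple-injective {2F} {0F} eq = ⊥-elim (x≢z (sym eq))
  triple-injective {2F} {1F} eq = ⊥-elim (y≢z (sym eq))

-- K_s takes s distinct colours, all forbidden on G, so G sees only the other two.
Avoids-join-twoColours : ∀ {n s} {G : Graph (Fin n)} {𝓜 : Matching G (2 + s)} {pick} →
  Avoids (joinMatching s 𝓜) pick → AtMostTwoColours (pick ∘ inj₁)
Avoids-join-twoColours {pick = pick} avoids x y z =
  outsideInjection-twoValues {g = pick ∘ inj₂} K-injective _ _ _ (∉K x) (∉K y) (∉K z)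
  where
  K-injective : Injective _≡_ _≡_ (pick ∘ inj₂)
  K-injective {w} {w′} eq with w ≟ᶠ w′
  ... | yes w≡w′ = w≡w′
  ... | no w≢w′  = ⊥-elim (avoids (inj₂ w) (inj₂ w′) (w≢w′ ∘ inj₂-injective) eq)

  ∉K : ∀ x w → pick (inj₁ x) ≢ pick (inj₂ w)
  ∉K x w = avoids (inj₁ x) (inj₂ w) (λ ())

module _ {V A B : Set} {N : ℕ} (view : V → A ⊎ B) (R : A → B → Fin N → Fin N → Set)
         (R-functionalʳ : ∀ {a b c d d′} → R a b c d → R a b c d′ → d ≡ d′)
         (R-functionalˡ : ∀ {a b c c′ d} → R a b c d → R a b c′ d → c ≡ c′) where

  private
    Across : A ⊎ B → A ⊎ B → Fin N → Fin N → Set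
    Across (inj₁ a) (inj₂ b) c d = R a b c d
    Across (inj₂ b) (inj₁ a) c d = R a b d c
    Across _        _        c d = ⊥

    Across-sym : ∀ v w {c d} → Across v w c d → Across w v d c
    Across-sym (inj₁ a) (inj₂ b) r = r
    Across-sym (inj₂ b) (inj₁ a) r = r

    Across-functional : ∀ v w {c d d′} → Across v w c d → Across v w c d′ → d ≡ d′
    Across-functional (inj₁ a) (inj₂ b) r r′ = R-functionalʳ r r′
    Across-functional (inj₂ b) (inj₁ a) r r′ = R-functionalˡ r r′

    Across-opposite : ∀ v w {c d} → Across v w c d → Opposite v w
    Across-opposite (inj₁ a) (inj₂ b) _ = left-right
    Across-opposite (inj₂ b) (inj₁ a) _ = right-left

  bipartiteMatching : Matching (Bipartite view) N
  bipartiteMatching = record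
    { Match      = λ x y → Across (view x) (view y)
    ; Match-sym  = λ {x} {y} → Across-sym (view x) (view y)
    ; functional = λ {x} {y} → Across-functional (view x) (view y)
    ; onEdges    = λ {x} {y} r _ → Across-opposite (view x) (view y) r
    }

  Avoids-bipartite : (embed : A ⊎ B → V) → (∀ w → view (embed w) ≡ w) →
    ∀ {col} → Avoids bipartiteMatching col →
    ∀ a b → ¬ R a b (col (embed (inj₁ a))) (col (embed (inj₂ b)))
  Avoids-bipartite embed section avoids a b r =
    avoids (embed (inj₁ a)) (embed (inj₂ b)) sides-differ
      (subst₂ (λ v w → Across v w _ _) (sym (section _)) (sym (section _)) r)
    where
    sides-differ : embed (inj₁ a) ≢ embed (inj₂ b)
    sides-differ eq with trans (sym (section _)) (trans (cong view eq) (section _))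
    ... | ()

-- For c, d, K < N this says c + d ≡ K (mod N).
SumsTo : ℕ → ℕ → ℕ → ℕ → Set
SumsTo N K c d = c + d ≡ K ⊎ c + d ≡ K + N

SumsTo-sym : ∀ {N K c d} → SumsTo N K c d → SumsTo N K d c
SumsTo-sym {c = c} {d} (inj₁ eq) = inj₁ (trans (+-comm d c) eq)
SumsTo-sym {c = c} {d} (inj₂ eq) = inj₂ (trans (+-comm d c) eq)

SumsTo-wraps⇒≥ : ∀ {N K c d d′} → c + d ≡ K → c + d′ ≡ K + N → N ≤ d′
SumsTo-wraps⇒≥ {N} {K} {c} {d} {d′} eq eq′ = subst (N ≤_) (sym d′≡d+N) (m≤n+m N d)
  where
  open ≡-Reasoning
  d′≡d+N : d′ ≡ d + N
  d′≡d+N = +-cancelˡ-≡ c d′ (d + N) (begin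
    c + d′       ≡⟨ eq′ ⟩
    K + N        ≡⟨ cong (_+ N) eq ⟨
    c + d + N    ≡⟨ +-assoc c d N ⟩
    c + (d + N)  ∎)

SumsTo-functional : ∀ {N K c d d′} → d < N → d′ < N → SumsTo N K c d → SumsTo N K c d′ → d ≡ d′
SumsTo-functional {c = c} _ _ (inj₁ eq) (inj₁ eq′) = +-cancelˡ-≡ c _ _ (trans eq (sym eq′))
SumsTo-functional {c = c} _ _ (inj₂ eq) (inj₂ eq′) = +-cancelˡ-≡ c _ _ (trans eq (sym eq′))
SumsTo-functional _ d′<N (inj₁ eq) (inj₂ eq′) = ⊥-elim (<⇒≱ d′<N (SumsTo-wraps⇒≥ eq eq′))
SumsTo-functional d<N _ (inj₂ eq) (inj₁ eq′) = ⊥-elim (<⇒≱ d<N (SumsTo-wraps⇒≥ eq′ eq))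

SumsTo-exists : ∀ {N c d} → c < N → d < N → ∃ λ K → K < N × SumsTo N K c d
SumsTo-exists {N} {c} {d} c<N d<N with c + d <? N
... | yes c+d<N = c + d , c+d<N , inj₁ refl
... | no  c+d≮N =
  c + d ∸ N , +-cancelʳ-< N _ _ (subst (_< N + N) (sym wrap) (+-mono-< c<N d<N)) , inj₂ (sym wrap)
  where
  wrap : c + d ∸ N + N ≡ c + d
  wrap = m∸n+n≡m (≮⇒≥ c+d≮N)

toℕ-combine-surjective : ∀ {m n K} → K < m * n → ∃₂ λ (i : Fin m) (j : Fin n) → toℕ (combine i j) ≡ K
toℕ-combine-surjective K<mn with combine-surjective (fromℕ< K<mn)
... | i , j , eq = i , j , trans (cong toℕ eq) (toℕ-fromℕ< K<mn)

-- Indexing the sides of K_{p+1,p+1} from 0, every edge at vertex 0 carries the identity matching,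
-- and the edge (i+1, j+1) carries the matching c + d ≡ combine i j (mod N).
SumFamily : ∀ p N → Fin (suc p) → Fin (suc p) → Fin N → Fin N → Set
SumFamily p N 0F       b        c d = c ≡ d
SumFamily p N (fsuc i) 0F       c d = c ≡ d
SumFamily p N (fsuc i) (fsuc j) c d = SumsTo N (toℕ (combine i j)) (toℕ c) (toℕ d)

SumFamily-functionalʳ : ∀ {p N a b c d d′} → SumFamily p N a b c d → SumFamily p N a b c d′ → d ≡ d′
SumFamily-functionalʳ {a = 0F}                  r r′ = trans (sym r) r′
SumFamily-functionalʳ {a = fsuc i} {0F}         r r′ = trans (sym r) r′
SumFamily-functionalʳ {a = fsuc i} {fsuc j} {c} {d} {d′} r r′ =
  toℕ-injective (SumsTo-functional {c = toℕ c} (toℕ<n d) (toℕ<n d′) r r′)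

SumFamily-functionalˡ : ∀ {p N a b c c′ d} → SumFamily p N a b c d → SumFamily p N a b c′ d → c ≡ c′
SumFamily-functionalˡ {a = 0F}                  r r′ = trans r (sym r′)
SumFamily-functionalˡ {a = fsuc i} {0F}         r r′ = trans r (sym r′)
SumFamily-functionalˡ {a = fsuc i} {fsuc j} {c} {c′} {d} r r′ =
  toℕ-injective (SumsTo-functional {c = toℕ d} (toℕ<n c) (toℕ<n c′)
    (SumsTo-sym {c = toℕ c} r) (SumsTo-sym {c = toℕ c′} r′))

SumFamily-unavoidable : ∀ {p N} → N ≤ p * p → (col : Fin (suc p) ⊎ Fin (suc p) → Fin N) →
  AtMostTwoColours col → ¬ (∀ a b → ¬ SumFamily p N a b (col (inj₁ a)) (col (inj₂ b)))
SumFamily-unavoidable {p} {N} N≤pp col twoColours avoids with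
  SumsTo-exists (toℕ<n (col (inj₁ 0F))) (toℕ<n (col (inj₂ 0F)))
... | K , K<N , αβ-sum with toℕ-combine-surjective {p} {p} (≤-trans K<N N≤pp)
... | i , j , combine≡K = avoids (fsuc i) (fsuc j) edge-matches
  where
  α≢B : ∀ b → col (inj₁ 0F) ≢ col (inj₂ b)
  α≢B b = avoids 0F b

  A≢β : ∀ a → col (inj₁ a) ≢ col (inj₂ 0F)
  A≢β 0F       = avoids 0F 0F
  A≢β (fsuc i) = avoids (fsuc i) 0F

  A≡α : col (inj₁ (fsuc i)) ≡ col (inj₁ 0F)
  A≡α = twoColours (inj₁ (fsuc i)) (inj₂ 0F) (inj₁ 0F) (A≢β (fsuc i)) (≢-sym (α≢B 0F))

  B≡β : col (inj₂ (fsuc j)) ≡ col (inj₂ 0F)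
  B≡β = twoColours (inj₂ (fsuc j)) (inj₁ 0F) (inj₂ 0F) (≢-sym (α≢B (fsuc j))) (α≢B 0F)

  edge-matches : SumFamily p N (fsuc i) (fsuc j) (col (inj₁ (fsuc i))) (col (inj₂ (fsuc j)))
  edge-matches rewrite A≡α | B≡β | combine≡K = αβ-sum

CompleteBipartite : ∀ q → Graph (Fin (q + q))
CompleteBipartite q = Bipartite (splitAt q)

sumMatching : ∀ p N → Matching (CompleteBipartite (suc p)) N
sumMatching p N =
  bipartiteMatching (splitAt (suc p)) (SumFamily p N) SumFamily-functionalʳ SumFamily-functionalˡ

sumCover : ∀ p s → Cover (Join (CompleteBipartite (suc p)) s)
sumCover p s = coverOf (joinMatching s (sumMatching p (2 + s)))

sumCover-uncolorable : ∀ {p s} → 2 + s ≤ p * p → ¬ CoverColorable (sumCover p s)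
sumCover-uncolorable {p} {s} bound colouring
  with pick , avoids ← coverOf-colouring (joinMatching s (sumMatching p (2 + s))) colouring =
  SumFamily-unavoidable bound (pick ∘ inj₁ ∘ join q q)
    (λ x y z → twoColours (join q q x) (join q q y) (join q q z))
    (Avoids-bipartite (splitAt q) (SumFamily p (2 + s)) SumFamily-functionalʳ SumFamily-functionalˡ
       (join q q) (splitAt-join q q) (Avoids-restrict {𝓜 = sumMatching p (2 + s)} avoids))
  where
  q : ℕ
  q = suc p
  twoColours : AtMostTwoColours (pick ∘ inj₁)
  twoColours = Avoids-join-twoColours {𝓜 = sumMatching p (2 + s)} avoids

<square∸double⇒ : ∀ q s → s < q * q ∸ (q + q) → ∃ λ p → q ≡ suc p × 2 + s ≤ p * p
<square∸double⇒ 0       s ()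
<square∸double⇒ (suc p) s s<bound =
  p , refl , +-cancelʳ-≤ (p + p) _ _ (s≤s⁻¹ (subst₂ _≤_ (lhs s p) (rhs p) sum≤square))
  where
  double<square : suc p + suc p < suc p * suc p
  double<square = m∸n≢0⇒n<m {suc p * suc p} (m<n⇒n≢0 s<bound)
  sum≤square : suc s + (suc p + suc p) ≤ suc p * suc p
  sum≤square = m≤o∸n⇒m+n≤o (suc s) (<⇒≤ double<square) s<bound
  lhs : ∀ s p → suc s + (suc p + suc p) ≡ suc (2 + s + (p + p))
  lhs = solve-∀
  rhs : ∀ p → suc p * suc p ≡ suc (p * p + (p + p))
  rhs = solve-∀

ZDP-completeBipartite : ∀ q → ZDPAtLeast (CompleteBipartite q) (q * q ∸ (q + q))
ZDP-completeBipartite q s s<bound with <square∸double⇒ q s s<bound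
... | p , refl , bound =
  colorable∧¬DPColorable⇒¬DPEqualsChromatic (Join-colorable s (Bipartite-colorable (splitAt q {q})))
    (λ dp → sumCover-uncolorable bound (dp (sumCover p s) (λ _ → ≤-refl)))

double≡twice : ∀ q → q * 2 ≡ q + q
double≡twice = solve-∀

quarterSquare∸n : ∀ q → q * 2 * (q * 2) / 4 ∸ q * 2 ≡ q * q ∸ (q + q)
quarterSquare∸n q =
  cong₂ _∸_ (trans (cong (_/ 4) (square-double q)) (m*n/n≡m (q * q) 4)) (double≡twice q)
  where
  square-double : ∀ q → q * 2 * (q * 2) ≡ q * q * 4
  square-double = solve-∀

theorem3p1 : (n : ℕ) → 2 ∣ n → ZDPnAtLeast n (n * n / 4 ∸ n)
theorem3p1 .(q * 2) (divides q refl) =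
  subst₂ ZDPnAtLeast (sym (double≡twice q)) (sym (quarterSquare∸n q))
    (CompleteBipartite q , ZDP-completeBipartite q)
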